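{- Let $i \geq 5$. Consider an occurrence $(s, e)$ in $T_i$ and let $S := T_i[s \ldots e]$. If $(s, e)$ is a proper super-occurrence of an occurrence of $T_{i-3}$ or of $\overline{T_{i-3}}$, and $S \notin \mathcal{P}_i := \{ T_{i-2}, \ \overline{T_{i-2}}, \ T_{i-4} \ \overline{T_{i-3}}, \ \overline{T_{i-4}} \ T_{i-3} \}$, then $(s, e)$ is not a net occurrence.
   Context: Strings are over $\{\texttt{a},\texttt{b}\}$. For a binary string $S$, $\overline{S}$ is obtained by swapping \texttt{a} and \texttt{b}. The Thue-Morse word is $T_1 := \texttt{a}$, $T_i := T_{i-1}\overline{T_{i-1}}$ for $i\ge 2$. An occurrence in a text is a pair of starting and ending positions $(s,e)$; $(s,e)$ is a super-occurrence of $(s',e')$ if $s \le s' \le e' \le e$, and proper if moreover $(s,e) \neq (s',e')$. An occurrence $(s,e)$ in a text $T$ is a net occurrence if $T[s\ldots e]$ occurs at least twice in $T$ while both $T[s-1\ldots e]$ and $T[s\ldots e+1]$ occur only once (when $s=1$ the left extension is taken to be unique; when $e=|T|$ the right extension is taken to be unique). -}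

module Defs where

open import Data.Nat using (ℕ; zero; suc; _∸_; _≤_; _<_)
open import Data.Bool using (Bool; true; false; _∧_) renaming (_≟_ to _≡?_)
open import Data.List using (List; []; _∷_; _++_; map; take; drop; length; filter; tails)
open import Data.Product using (Σ; _×_; ∃; ∃-syntax; _,_)
open import Data.Sum using (_⊎_)
open import Relation.Nullary using (¬_)
open import Relation.Binary.PropositionalEquality using (_≡_)

data AB : Set where
  a b : AB

_==_ : AB → AB → Bool
a == a = true
b == b = true
a == b = false
b == a = false

flip : AB → AB
flip a = b
flip b = a

bar : List AB → List AB
bar = map flip

-- Thue–Morse words, 1-indexed: TM 1 = a, TM i = TM (i-1) ++ bar (TM (i-1)) for i ≥ 2.
-- (TM 0 is an unused junk value, set to [a].)
TM : ℕ → List AB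
TM zero = a ∷ []
TM (suc zero) = a ∷ []
TM (suc (suc n)) = TM (suc n) ++ bar (TM (suc n))

isPrefix : List AB → List AB → Bool
isPrefix [] t = true
isPrefix (x ∷ w) [] = false
isPrefix (x ∷ w) (y ∷ t) = (x == y) ∧ isPrefix w t

occCount : List AB → List AB → ℕ
occCount w t = length (filter (λ u → isPrefix w u ≡? true) (tails t))

-- T[s … e] with 1-indexed positions (meaningful when 1 ≤ s ≤ e ≤ |T|)
sub : List AB → ℕ → ℕ → List AB
sub T s e = take (suc e ∸ s) (drop (s ∸ 1) T)

IsOcc : List AB → ℕ → ℕ → Set
IsOcc T s e = (1 ≤ s) × (s ≤ e) × (e ≤ length T)

-- net occurrence: T[s..e] occurs at least twice, and both one-character
-- extensions occur exactly once (a missing extension counts as unique).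
IsNetOcc : List AB → ℕ → ℕ → Set
IsNetOcc T s e =
  (2 ≤ occCount (sub T s e) T)
  × ((s ≡ 1) ⊎ (occCount (sub T (s ∸ 1) e) T ≡ 1))
  × ((e ≡ length T) ⊎ (occCount (sub T s (suc e)) T ≡ 1))

ProperSuperOccOf : List AB → ℕ → ℕ → List AB → Set
ProperSuperOccOf T s e w =
  ∃[ s' ] ∃[ e' ] ((s ≤ s') × (s' ≤ e') × (e' ≤ e) × ¬ ((s ≡ s') × (e ≡ e'))
                   × (sub T s' e' ≡ w))

{-# OPTIONS --safe #-}
module Submission where

open import Defs
open import Data.Bool using (Bool; true; false; _∧_)
open import Data.Bool.Properties using (∧-zeroʳ)
open import Data.Empty using (⊥-elim)
open import Data.List using (List; []; _∷_; _++_; _∷ʳ_; map; take; length; last; head; InitLast; initLast; _∷ʳ′_)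
open import Data.List.Properties using (≡-dec; ++-assoc; ∷-injective; ∷-injectiveʳ; length-++)
open import Data.List.Membership.Propositional using (_∈_; _∉_)
open import Data.List.Membership.Propositional.Properties using (∈-map⁺)
open import Data.List.Relation.Unary.Any using (here; there; any?)
import Data.List.Relation.Unary.All as ListAll
open import Data.Maybe using (Maybe; just)
import Data.Maybe as Maybe
open import Data.Maybe.Relation.Unary.All using (All; just; nothing)
import Data.Maybe.Relation.Unary.All as All
open import Data.Maybe.Relation.Unary.All.Properties using (map⁻)
open import Data.Nat using (ℕ; zero; suc; _+_; _∸_; _≤_; z≤n; s≤s; _≤?_)
import Data.Nat as ℕ
open import Data.Nat.Properties
  using (+-identityʳ; +-comm; +-suc; suc-injective; +-cancelˡ-≡; +-cancelˡ-≤; +-monoʳ-≤; m≤m+n; m≢1+m+n;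
         m≤n⇒∃[o]m+o≡n; ≤-trans; ≤-reflexive; ≤-pred; <⇒≤)
open import Data.Nat.Tactic.RingSolver using (solve-∀)
open import Data.Product using (_×_; _,_; ∃; ∃₂; proj₁; proj₂; map₁)
open import Data.Sum using (_⊎_; inj₁; inj₂; swap; [_,_])
import Data.Sum as Sum
open import Function using (id; _∘_)
open import Relation.Binary.Definitions using (DecidableEquality)
open import Relation.Binary.PropositionalEquality using (_≡_; _≢_; refl; sym; trans; cong; cong₂; subst)
open import Relation.Nullary using (¬_; Dec; yes; no)
open import Relation.Nullary.Decidable using (_×-dec_; _→-dec_; from-yes)

open Relation.Binary.PropositionalEquality.≡-Reasoning

-- T (i + 1) = μ (T i) for the Thue–Morse morphism μ x = x x̄. Squares in a μ-image only straddle two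
-- blocks, so T (i - 3) = μ (T (i - 4)), which begins x x̄ x̄ x, occurs in μ-images only at even
-- positions, and every word S containing it (or its complement) occurs in μ-images either only at even
-- or only at odd positions. Take a net occurrence of such an S in T i = μ (T (i - 1)). If it began at an
-- odd position, every occurrence of S would be preceded by the same letter, so its left extension would
-- occur as often as S; if it ended in the middle of a block, the same would hold for its right extension.
-- Hence S = μ S′ for a net occurrence S′ in T (i - 1) containing T (i - 4) or its complement. Descending
-- to i = 5, where every net occurrence lies in 𝒫 5 by evaluation, and using μ (𝒫 (i - 1)) = 𝒫 i, S ∈ 𝒫 i.

μ : List AB → List AB
μ []      = []
μ (x ∷ w) = x ∷ flip x ∷ μ w

μ-++ : ∀ u v → μ (u ++ v) ≡ μ u ++ μ v
μ-++ []      v = refl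
μ-++ (x ∷ u) v = cong (λ w → x ∷ flip x ∷ w) (μ-++ u v)

μ-bar : ∀ u → μ (bar u) ≡ bar (μ u)
μ-bar []      = refl
μ-bar (x ∷ u) = cong (λ w → flip x ∷ flip (flip x) ∷ w) (μ-bar u)

μ-injective : ∀ {u v} → μ u ≡ μ v → u ≡ v
μ-injective {[]}    {[]}    _  = refl
μ-injective {x ∷ u} {y ∷ v} eq with ∷-injective eq
... | refl , eq′ = cong (x ∷_) (μ-injective (∷-injectiveʳ eq′))

μ≢μ∷ʳ : ∀ u v z → μ u ≢ μ v ∷ʳ z
μ≢μ∷ʳ []      []      z ()
μ≢μ∷ʳ []      (y ∷ v) z ()
μ≢μ∷ʳ (x ∷ u) []      z ()
μ≢μ∷ʳ (x ∷ u) (y ∷ v) z eq = μ≢μ∷ʳ u v z (∷-injectiveʳ (∷-injectiveʳ eq))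

last-μ : ∀ L → last (μ L) ≡ Maybe.map flip (last L)
last-μ []          = refl
last-μ (x ∷ [])    = refl
last-μ (x ∷ y ∷ L) = last-μ (y ∷ L)

head-μ : ∀ R → head (μ R) ≡ head R
head-μ []      = refl
head-μ (x ∷ R) = refl

data Cut (u L M : List AB) : Set where
  between : ∀ L′ M′ → u ≡ L′ ++ M′ → L ≡ μ L′ → M ≡ μ M′ → Cut u L M
  inside  : ∀ L′ x M′ → u ≡ L′ ++ x ∷ M′ → L ≡ μ L′ ∷ʳ x → M ≡ flip x ∷ μ M′ → Cut u L M

μ-cut : ∀ u L M → μ u ≡ L ++ M → Cut u L M
μ-cut u       []          M eq = between [] u refl refl (sym eq)
μ-cut (x ∷ u) (y ∷ [])    M eq with ∷-injective eq
... | refl , M≡ = inside [] x u refl refl (sym M≡)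
μ-cut (x ∷ u) (y ∷ z ∷ L) M eq with ∷-injective eq
... | refl , eq′ with ∷-injective eq′
... | refl , eq″ with μ-cut u L M eq″
... | between L′ M′ u≡ L≡ M≡ = between (x ∷ L′) M′ (cong (x ∷_) u≡) (cong (λ w → x ∷ flip x ∷ w) L≡) M≡
... | inside L′ x′ M′ u≡ L≡ M≡ = inside (x ∷ L′) x′ M′ (cong (x ∷_) u≡) (cong (λ w → x ∷ flip x ∷ w) L≡) M≡

TM-μ : ∀ j → TM (suc (suc j)) ≡ μ (TM (suc j))
TM-μ zero    = refl
TM-μ (suc j) = begin
  TM (suc (suc j)) ++ bar (TM (suc (suc j)))  ≡⟨ cong (λ t → t ++ bar t) (TM-μ j) ⟩
  μ (TM (suc j)) ++ bar (μ (TM (suc j)))      ≡⟨ cong (μ (TM (suc j)) ++_) (sym (μ-bar (TM (suc j)))) ⟩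
  μ (TM (suc j)) ++ μ (bar (TM (suc j)))      ≡⟨ sym (μ-++ (TM (suc j)) (bar (TM (suc j)))) ⟩
  μ (TM (suc (suc j)))                        ∎

bar-TM-μ : ∀ j → bar (TM (suc (suc j))) ≡ μ (bar (TM (suc j)))
bar-TM-μ j = trans (cong bar (TM-μ j)) (sym (μ-bar (TM (suc j))))

TM-starts-ab : ∀ k → ∃ λ w → TM (2 + k) ≡ a ∷ b ∷ w
TM-starts-ab zero    = [] , refl
TM-starts-ab (suc k) with TM-starts-ab k
... | w , eq = w ++ bar (TM (2 + k)) , cong (_++ bar (TM (2 + k))) eq

-- Synchronising words

isPrefix-++ : ∀ w v → isPrefix w (w ++ v) ≡ true
isPrefix-++ []      v = refl
isPrefix-++ (a ∷ w) v = isPrefix-++ w v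
isPrefix-++ (b ∷ w) v = isPrefix-++ w v

isPrefix-≡++ : ∀ w v {t} → w ++ v ≡ t → isPrefix w t ≡ true
isPrefix-≡++ w v refl = isPrefix-++ w v

isPrefix-++-false : ∀ w v {t} → isPrefix w t ≡ false → isPrefix (w ++ v) t ≡ false
isPrefix-++-false []      v         ()
isPrefix-++-false (x ∷ w) v {[]}    _ = refl
isPrefix-++-false (x ∷ w) v {y ∷ t} p with x == y
... | true  = isPrefix-++-false w v p
... | false = refl

isPrefix-μ : ∀ w v → isPrefix (μ w) (μ v) ≡ isPrefix w v
isPrefix-μ []      v       = refl
isPrefix-μ (x ∷ w) []      = refl
isPrefix-μ (a ∷ w) (a ∷ v) = isPrefix-μ w v
isPrefix-μ (a ∷ w) (b ∷ v) = refl
isPrefix-μ (b ∷ w) (a ∷ v) = refl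
isPrefix-μ (b ∷ w) (b ∷ v) = isPrefix-μ w v

isPrefix-μ-∷ʳ : ∀ w y v → isPrefix (μ w ∷ʳ y) (μ v) ≡ isPrefix (w ∷ʳ y) v
isPrefix-μ-∷ʳ []      y []      = refl
isPrefix-μ-∷ʳ []      y (c ∷ v) = refl
isPrefix-μ-∷ʳ (x ∷ w) y []      = refl
isPrefix-μ-∷ʳ (a ∷ w) y (a ∷ v) = isPrefix-μ-∷ʳ w y v
isPrefix-μ-∷ʳ (a ∷ w) y (b ∷ v) = refl
isPrefix-μ-∷ʳ (b ∷ w) y (a ∷ v) = refl
isPrefix-μ-∷ʳ (b ∷ w) y (b ∷ v) = isPrefix-μ-∷ʳ w y v

NeverEven : List AB → Set
NeverEven w = ∀ v → isPrefix w (μ v) ≡ false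

-- A suffix of μ (c ∷ v) starting at an odd position is flip c ∷ μ v; here the first letter is arbitrary.
NeverOdd : List AB → Set
NeverOdd w = ∀ x v → isPrefix w (x ∷ μ v) ≡ false

neverEven-∷ : ∀ x w → NeverOdd w → NeverEven (x ∷ w)
neverEven-∷ x w never []      = refl
neverEven-∷ x w never (c ∷ v) = trans (cong ((x == c) ∧_) (never (flip c) v)) (∧-zeroʳ (x == c))

neverOdd-∷ : ∀ x w → NeverEven w → NeverOdd (x ∷ w)
neverOdd-∷ x w never c v = trans (cong ((x == c) ∧_) (never v)) (∧-zeroʳ (x == c))

neverOdd-++ : ∀ w v → NeverOdd w → NeverOdd (w ++ v)
neverOdd-++ w v never x u = isPrefix-++-false w v (never x u)

neverEven-square : ∀ y w → NeverEven (y ∷ y ∷ w)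
neverEven-square y w []      = refl
neverEven-square a w (a ∷ v) = refl
neverEven-square a w (b ∷ v) = refl
neverEven-square b w (a ∷ v) = refl
neverEven-square b w (b ∷ v) = refl

neverOdd-square : ∀ x y w → NeverOdd (x ∷ y ∷ y ∷ w)
neverOdd-square x y w = neverOdd-∷ x (y ∷ y ∷ w) (neverEven-square y w)

neverOdd-μ-TM : ∀ k → NeverOdd (μ (TM (2 + k))) × NeverOdd (μ (bar (TM (2 + k))))
neverOdd-μ-TM k with TM-starts-ab k
... | w , eq = subst (NeverOdd ∘ μ) (sym eq) (neverOdd-square a b (a ∷ μ w))
             , subst (NeverOdd ∘ μ ∘ bar) (sym eq) (neverOdd-square b a (b ∷ μ (bar w)))

Infix : List AB → List AB → Set
Infix w S = ∃₂ λ α β → S ≡ α ++ w ++ β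

infix-dichotomy : ∀ {w S} → NeverOdd w → Infix w S → NeverOdd S ⊎ NeverEven S
infix-dichotomy {w} never ([]    , β , refl) = inj₁ (neverOdd-++ w β never)
infix-dichotomy {w} never (x ∷ α , β , refl) =
  swap (Sum.map (neverEven-∷ x (α ++ w ++ β)) (neverOdd-∷ x (α ++ w ++ β)) (infix-dichotomy never (α , β , refl)))

true≢false : true ≢ false
true≢false ()

neverEven-≢μ : ∀ S R M → NeverEven S → S ++ R ≢ μ M
neverEven-≢μ S R M never eq = true≢false (trans (sym (isPrefix-≡++ S R eq)) (never M))

neverOdd-≢∷μ : ∀ S R x M → NeverOdd S → S ++ R ≢ x ∷ μ M
neverOdd-≢∷μ S R x M never eq = true≢false (trans (sym (isPrefix-≡++ S R eq)) (never x M))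

synchronised-even : ∀ S R M → S ++ R ≡ μ M → NeverOdd S ⊎ NeverEven S → NeverOdd S
synchronised-even S R M SR≡ = [ id , (λ never → ⊥-elim (neverEven-≢μ S R M never SR≡)) ]

synchronised-odd : ∀ S R x M → S ++ R ≡ x ∷ μ M → NeverOdd S ⊎ NeverEven S → NeverEven S
synchronised-odd S R x M SR≡ = [ (λ never → ⊥-elim (neverOdd-≢∷μ S R x M never SR≡)) , id ]

infix-μ⁻ : ∀ Y S → NeverOdd (μ Y) → Infix (μ Y) (μ S) → Infix Y S
infix-μ⁻ Y S never (α , β , eq) with μ-cut S α (μ Y ++ β) eq
... | inside α′ x M _ _ YM≡ = ⊥-elim (neverOdd-≢∷μ (μ Y) β (flip x) M never YM≡)
... | between α′ M S≡ refl YM≡ with μ-cut M (μ Y) β (sym YM≡)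
...   | inside Y′ z β′ _ Y≡ _ = ⊥-elim (μ≢μ∷ʳ Y Y′ z Y≡)
...   | between Y′ β′ M≡ Y≡ refl with μ-injective Y≡
...     | refl = α′ , β′ , trans S≡ (cong (α′ ++_) M≡)

𝟙 : Bool → ℕ
𝟙 true  = 1
𝟙 false = 0

occCount-[] : ∀ w → occCount w [] ≡ 𝟙 (isPrefix w [])
occCount-[] w with isPrefix w []
... | true  = refl
... | false = refl

occCount-∷ : ∀ w x t → occCount w (x ∷ t) ≡ 𝟙 (isPrefix w (x ∷ t)) + occCount w t
occCount-∷ w x t with isPrefix w (x ∷ t)
... | true  = refl
... | false = refl

evenOcc : List AB → List AB → ℕ
evenOcc w []      = 𝟙 (isPrefix w [])
evenOcc w (c ∷ u) = 𝟙 (isPrefix w (μ (c ∷ u))) + evenOcc w u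

oddOcc : List AB → List AB → ℕ
oddOcc w []      = 0
oddOcc w (c ∷ u) = 𝟙 (isPrefix w (flip c ∷ μ u)) + oddOcc w u

occCount-μ : ∀ w u → occCount w (μ u) ≡ evenOcc w u + oddOcc w u
occCount-μ w []      = trans (occCount-[] w) (sym (+-identityʳ _))
occCount-μ w (c ∷ u) = begin
  occCount w (c ∷ flip c ∷ μ u)                ≡⟨ occCount-∷ w c (flip c ∷ μ u) ⟩
  even₀ + occCount w (flip c ∷ μ u)            ≡⟨ cong (even₀ +_) (occCount-∷ w (flip c) (μ u)) ⟩
  even₀ + (odd₀ + occCount w (μ u))            ≡⟨ cong (λ n → even₀ + (odd₀ + n)) (occCount-μ w u) ⟩
  even₀ + (odd₀ + (evenOcc w u + oddOcc w u))  ≡⟨ interchange even₀ odd₀ (evenOcc w u) (oddOcc w u) ⟩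
  (even₀ + evenOcc w u) + (odd₀ + oddOcc w u)  ∎
  where
  even₀ = 𝟙 (isPrefix w (μ (c ∷ u)))
  odd₀  = 𝟙 (isPrefix w (flip c ∷ μ u))
  interchange : ∀ m n o p → m + (n + (o + p)) ≡ (m + o) + (n + p)
  interchange = solve-∀

evenOcc-pullback : ∀ w w′ → (∀ v → isPrefix w (μ v) ≡ isPrefix w′ v) →
                   ∀ u → evenOcc w u ≡ occCount w′ u
evenOcc-pullback w w′ same []      = trans (cong 𝟙 (same [])) (sym (occCount-[] w′))
evenOcc-pullback w w′ same (c ∷ u) =
  trans (cong₂ _+_ (cong 𝟙 (same (c ∷ u))) (evenOcc-pullback w w′ same u)) (sym (occCount-∷ w′ c u))

oddOcc≡evenOcc : ∀ x w u → oddOcc (flip x ∷ w) u ≡ evenOcc (x ∷ flip x ∷ w) u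
oddOcc≡evenOcc x w []      = refl
oddOcc≡evenOcc x w (c ∷ u) = cong₂ _+_ (cong 𝟙 (preceded x c)) (oddOcc≡evenOcc x w u)
  where
  preceded : ∀ x c → isPrefix (flip x ∷ w) (flip c ∷ μ u) ≡ isPrefix (x ∷ flip x ∷ w) (c ∷ flip c ∷ μ u)
  preceded a a = refl
  preceded a b = refl
  preceded b a = refl
  preceded b b = refl

evenOcc-never : ∀ w → NeverEven w → ∀ u → evenOcc w u ≡ 0
evenOcc-never w never []      = cong 𝟙 (never [])
evenOcc-never w never (c ∷ u) = cong₂ _+_ (cong 𝟙 (never (c ∷ u))) (evenOcc-never w never u)

oddOcc-never : ∀ w → NeverOdd w → ∀ u → oddOcc w u ≡ 0
oddOcc-never w never []      = refl
oddOcc-never w never (c ∷ u) = cong₂ _+_ (cong 𝟙 (never (flip c) u)) (oddOcc-never w never u)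

occCount-μ-even : ∀ w u → NeverOdd w → occCount w (μ u) ≡ evenOcc w u
occCount-μ-even w u never =
  trans (occCount-μ w u) (trans (cong (evenOcc w u +_) (oddOcc-never w never u)) (+-identityʳ _))

occCount-μ-odd : ∀ w u → NeverEven w → occCount w (μ u) ≡ oddOcc w u
occCount-μ-odd w u never = trans (occCount-μ w u) (cong (_+ oddOcc w u) (evenOcc-never w never u))

occCount-μ⁻ : ∀ w u → NeverOdd (μ w) → occCount (μ w) (μ u) ≡ occCount w u
occCount-μ⁻ w u never =
  trans (occCount-μ-even (μ w) u never) (evenOcc-pullback (μ w) w (isPrefix-μ w) u)

occCount-μ⁻-∷ʳ : ∀ w y u → NeverOdd (μ w ∷ʳ y) → occCount (μ w ∷ʳ y) (μ u) ≡ occCount (w ∷ʳ y) u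
occCount-μ⁻-∷ʳ w y u never =
  trans (occCount-μ-even (μ w ∷ʳ y) u never) (evenOcc-pullback (μ w ∷ʳ y) (w ∷ʳ y) (isPrefix-μ-∷ʳ w y) u)

occCount-μ⁻-∷ : ∀ z w u → NeverOdd (μ w) → occCount (flip z ∷ μ w) (μ u) ≡ occCount (z ∷ w) u
occCount-μ⁻-∷ z w u never = begin
  occCount (flip z ∷ μ w) (μ u)  ≡⟨ occCount-μ-odd (flip z ∷ μ w) u (neverEven-∷ (flip z) (μ w) never) ⟩
  oddOcc (flip z ∷ μ w) u        ≡⟨ oddOcc≡evenOcc z (μ w) u ⟩
  evenOcc (μ (z ∷ w)) u          ≡⟨ evenOcc-pullback (μ (z ∷ w)) (z ∷ w) (isPrefix-μ (z ∷ w)) u ⟩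
  occCount (z ∷ w) u             ∎

occCount-μ-extendˡ : ∀ x w u → NeverEven (flip x ∷ w) →
                     occCount (x ∷ flip x ∷ w) (μ u) ≡ occCount (flip x ∷ w) (μ u)
occCount-μ-extendˡ x w u never = begin
  occCount (x ∷ flip x ∷ w) (μ u)  ≡⟨ occCount-μ-even (x ∷ flip x ∷ w) u (neverOdd-∷ x (flip x ∷ w) never) ⟩
  evenOcc (x ∷ flip x ∷ w) u       ≡⟨ sym (oddOcc≡evenOcc x w u) ⟩
  oddOcc (flip x ∷ w) u            ≡⟨ sym (occCount-μ-odd (flip x ∷ w) u never) ⟩
  occCount (flip x ∷ w) (μ u)      ∎

occCount-μ-extendʳ : ∀ w y u → NeverOdd (μ w ∷ʳ y) →
                     occCount (μ w ∷ʳ y ∷ʳ flip y) (μ u) ≡ occCount (μ w ∷ʳ y) (μ u)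
occCount-μ-extendʳ w y u never = begin
  occCount (μ w ∷ʳ y ∷ʳ flip y) (μ u)  ≡⟨ cong (λ v → occCount v (μ u)) μ-block ⟩
  occCount (μ (w ∷ʳ y)) (μ u)          ≡⟨ occCount-μ⁻ (w ∷ʳ y) u (subst NeverOdd μ-block never′) ⟩
  occCount (w ∷ʳ y) u                  ≡⟨ sym (occCount-μ⁻-∷ʳ w y u never) ⟩
  occCount (μ w ∷ʳ y) (μ u)            ∎
  where
  μ-block : μ w ∷ʳ y ∷ʳ flip y ≡ μ (w ∷ʳ y)
  μ-block = trans (++-assoc (μ w) (y ∷ []) (flip y ∷ [])) (sym (μ-++ w (y ∷ [])))
  never′ : NeverOdd (μ w ∷ʳ y ∷ʳ flip y)
  never′ = neverOdd-++ (μ w ∷ʳ y) (flip y ∷ []) never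

-- l and r are the letters just before and just after the occurrence of S, if any.
NetOccurrence : List AB → Maybe AB → List AB → Maybe AB → Set
NetOccurrence T l S r =
  2 ≤ occCount S T × All (λ x → occCount (x ∷ S) T ≡ 1) l × All (λ y → occCount (S ∷ʳ y) T ≡ 1) r

unique⇒¬repeated : ∀ {n} → n ≡ 1 → ¬ 2 ≤ n
unique⇒¬repeated refl (s≤s ())

last-∷ʳ : ∀ (xs : List AB) x → last (xs ∷ʳ x) ≡ just x
last-∷ʳ []           x = refl
last-∷ʳ (y ∷ [])     x = refl
last-∷ʳ (y ∷ z ∷ xs) x = last-∷ʳ (z ∷ xs) x

net-odd-start : ∀ x S R M u {r} → S ++ R ≡ flip x ∷ μ M → NeverEven S → ¬ NetOccurrence (μ u) (just x) S r
net-odd-start x []      R M u SR≡ never _ = true≢false (never [])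
net-odd-start x (c ∷ S) R M u SR≡ never (repeated , just unique , _) with ∷-injective SR≡
... | refl , _ = unique⇒¬repeated (trans (sym (occCount-μ-extendˡ x S u never)) unique) repeated

net-odd-end : ∀ w y u {l} → NeverOdd (μ w ∷ʳ y) → ¬ NetOccurrence (μ u) l (μ w ∷ʳ y) (just (flip y))
net-odd-end w y u never (repeated , _ , just unique) =
  unique⇒¬repeated (trans (sym (occCount-μ-extendʳ w y u never)) unique) repeated

net-μ⁻-aligned : ∀ L w R u → NeverOdd (μ w) →
  NetOccurrence (μ u) (last (μ L)) (μ w) (head (μ R)) → NetOccurrence u (last L) w (head R)
net-μ⁻-aligned L w R u never (repeated , left , right) =
    subst (2 ≤_) (occCount-μ⁻ w u never) repeated
  , All.map (λ {z} unique → trans (sym (occCount-μ⁻-∷ z w u never)) unique)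
            (map⁻ (subst (All _) (last-μ L) left))
  , All.map (λ {y} unique → trans (sym (occCount-μ⁻-∷ʳ w y u (neverOdd-++ (μ w) (y ∷ []) never))) unique)
            (subst (All _) (head-μ R) right)

net-μ⁻ : ∀ u L S R → μ u ≡ L ++ S ++ R → NeverOdd S ⊎ NeverEven S →
  NetOccurrence (μ u) (last L) S (head R) →
  ∃ λ ((L′ , S′ , R′) : List AB × List AB × List AB) →
    u ≡ L′ ++ S′ ++ R′ × S ≡ μ S′ × NetOccurrence u (last L′) S′ (head R′)
net-μ⁻ u L S R eq sync net with μ-cut u L (S ++ R) eq
... | inside L′ x M′ _ refl SR≡ =
  ⊥-elim (net-odd-start x S R M′ u SR≡ (synchronised-odd S R (flip x) M′ SR≡ sync)
                        (subst (λ l → NetOccurrence (μ u) l S (head R)) (last-∷ʳ (μ L′) x) net))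
... | between L′ M′ u≡ refl SR≡ with μ-cut M′ S R (sym SR≡)
...   | inside S′ y R′ _ refl refl = ⊥-elim (net-odd-end S′ y u (synchronised-even S R M′ SR≡ sync) net)
...   | between S′ R′ M≡ refl refl =
  (L′ , S′ , R′) , trans u≡ (cong (L′ ++_) M≡) , refl ,
  net-μ⁻-aligned L′ S′ R′ u (synchronised-even S R M′ SR≡ sync) net

ContainsTM : ℕ → List AB → Set
ContainsTM j S = Infix (TM j) S ⊎ Infix (bar (TM j)) S

ContainsTM-dichotomy : ∀ k {S} → ContainsTM (3 + k) S → NeverOdd S ⊎ NeverEven S
ContainsTM-dichotomy k {S} =
  [ infix-dichotomy (proj₁ (neverOdd-μ-TM k)) ∘ subst (λ X → Infix X S) (TM-μ (1 + k))
  , infix-dichotomy (proj₂ (neverOdd-μ-TM k)) ∘ subst (λ X → Infix X S) (bar-TM-μ (1 + k)) ]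

ContainsTM-μ⁻ : ∀ k S → ContainsTM (3 + k) (μ S) → ContainsTM (2 + k) S
ContainsTM-μ⁻ k S = Sum.map
  (infix-μ⁻ (TM (2 + k)) S (proj₁ (neverOdd-μ-TM k)) ∘ subst (λ X → Infix X (μ S)) (TM-μ (1 + k)))
  (infix-μ⁻ (bar (TM (2 + k))) S (proj₂ (neverOdd-μ-TM k)) ∘ subst (λ X → Infix X (μ S)) (bar-TM-μ (1 + k)))

𝒫 : ℕ → List (List AB)
𝒫 i = TM (i ∸ 2) ∷ bar (TM (i ∸ 2))
    ∷ (TM (i ∸ 4) ++ bar (TM (i ∸ 3))) ∷ (bar (TM (i ∸ 4)) ++ TM (i ∸ 3)) ∷ []

μ-𝒫 : ∀ k → map μ (𝒫 (5 + k)) ≡ 𝒫 (6 + k)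
μ-𝒫 k = cong₂ _∷_ (sym (TM-μ (2 + k))) (cong₂ _∷_ (sym (bar-TM-μ (2 + k)))
          (cong₂ _∷_ (μ-concat (TM (1 + k)) (bar (TM (2 + k))) (TM-μ k) (bar-TM-μ (1 + k)))
          (cong₂ _∷_ (μ-concat (bar (TM (1 + k))) (TM (2 + k)) (bar-TM-μ k) (TM-μ (1 + k))) refl)))
  where
  μ-concat : ∀ u v {u′ v′} → u′ ≡ μ u → v′ ≡ μ v → μ (u ++ v) ≡ u′ ++ v′
  μ-concat u v refl refl = μ-++ u v

_≟_ : DecidableEquality AB
a ≟ a = yes refl
a ≟ b = no λ ()
b ≟ a = no λ ()
b ≟ b = yes refl

netOccurrence? : ∀ T l S r → Dec (NetOccurrence T l S r)
netOccurrence? T l S r =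
  2 ≤? occCount S T
  ×-dec All.dec (λ x → occCount (x ∷ S) T ℕ.≟ 1) l
  ×-dec All.dec (λ y → occCount (S ∷ʳ y) T ℕ.≟ 1) r

splits : List AB → List (List AB × List AB)
splits []      = ([] , []) ∷ []
splits (x ∷ t) = ([] , x ∷ t) ∷ map (map₁ (x ∷_)) (splits t)

∈-splits : ∀ L M → (L , M) ∈ splits (L ++ M)
∈-splits []      []      = here refl
∈-splits []      (x ∷ M) = here refl
∈-splits (x ∷ L) M       = there (∈-map⁺ (map₁ (x ∷_)) (∈-splits L M))

net⇒∈𝒫₅-by-evaluation :
  ListAll.All (λ (L , M) → ListAll.All (λ (S , R) → NetOccurrence (TM 5) (last L) S (head R) → S ∈ 𝒫 5)
                                       (splits M))
              (splits (TM 5))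
net⇒∈𝒫₅-by-evaluation = from-yes
  (ListAll.all? (λ (L , M) → ListAll.all? (λ (S , R) →
     netOccurrence? (TM 5) (last L) S (head R) →-dec any? (≡-dec _≟_ S) (𝒫 5)) (splits M)) (splits (TM 5)))

net⇒∈𝒫₅ : ∀ L S R → TM 5 ≡ L ++ S ++ R → NetOccurrence (TM 5) (last L) S (head R) → S ∈ 𝒫 5
net⇒∈𝒫₅ L S R eq = ListAll.lookup (ListAll.lookup net⇒∈𝒫₅-by-evaluation L,S++R∈) (∈-splits S R)
  where
  L,S++R∈ : (L , S ++ R) ∈ splits (TM 5)
  L,S++R∈ = subst (λ T → (L , S ++ R) ∈ splits T) (sym eq) (∈-splits L (S ++ R))

net⇒∈𝒫 : ∀ k L S R → TM (5 + k) ≡ L ++ S ++ R → ContainsTM (2 + k) S →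
          NetOccurrence (TM (5 + k)) (last L) S (head R) → S ∈ 𝒫 (5 + k)
net⇒∈𝒫 zero    L S R eq _ net = net⇒∈𝒫₅ L S R eq net
net⇒∈𝒫 (suc k) L S R eq contains net
  with net-μ⁻ (TM (5 + k)) L S R (trans (sym (TM-μ (4 + k))) eq) (ContainsTM-dichotomy k contains)
              (subst (λ T → NetOccurrence T (last L) S (head R)) (TM-μ (4 + k)) net)
... | (L′ , S′ , R′) , eq′ , refl , net′ =
  subst (μ S′ ∈_) (μ-𝒫 k)
        (∈-map⁺ μ (net⇒∈𝒫 k L′ S′ R′ eq′ (ContainsTM-μ⁻ k S′ contains) net′))

take-length-++ : ∀ (S R : List AB) → take (length S) (S ++ R) ≡ S
take-length-++ []      R = refl
take-length-++ (x ∷ S) R = cong (x ∷_) (take-length-++ S R)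

sub-++ : ∀ L S R → sub (L ++ S ++ R) (suc (length L)) (length L + length S) ≡ S
sub-++ []      S R = take-length-++ S R
sub-++ (x ∷ L) S R = sub-++ L S R

sub-factor : ∀ {T s e} L S R → T ≡ L ++ S ++ R → s ≡ suc (length L) → e ≡ length L + length S →
             sub T s e ≡ S
sub-factor L S R refl refl refl = sub-++ L S R

length-∷ʳ : ∀ (xs : List AB) x → length (xs ∷ʳ x) ≡ suc (length xs)
length-∷ʳ xs x = trans (length-++ xs) (+-comm (length xs) 1)

length-factor : ∀ (L S R : List AB) → length (L ++ S ++ R) ≡ length L + (length S + length R)
length-factor L S R = trans (length-++ L) (cong (length L +_) (length-++ S))

splitAt-length : ∀ n (T : List AB) → n ≤ length T → ∃₂ λ L M → T ≡ L ++ M × length L ≡ n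
splitAt-length zero    T       _        = [] , T , refl , refl
splitAt-length (suc n) (x ∷ T) (s≤s n≤) with splitAt-length n T n≤
... | L , M , refl , refl = x ∷ L , M , refl , refl

++-split-≤ : ∀ (A A′ : List AB) {M M′} → A ++ M ≡ A′ ++ M′ → length A ≤ length A′ →
             ∃ λ γ → A′ ≡ A ++ γ × M ≡ γ ++ M′
++-split-≤ []      A′       eq _         = A′ , refl , eq
++-split-≤ (x ∷ A) (y ∷ A′) eq (s≤s A≤) with ∷-injective eq
... | refl , eq′ with ++-split-≤ A A′ eq′ A≤
... | γ , refl , M≡ = γ , refl , M≡

occurrence⇒factorization : ∀ T {s e} → IsOcc T s e →
  ∃ λ ((L , S , R) : List AB × List AB × List AB) →
    T ≡ L ++ S ++ R × s ≡ suc (length L) × e ≡ length L + length S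
occurrence⇒factorization T {suc d} {e} (_ , d<e , e≤) with splitAt-length e T e≤
... | P , R , refl , refl with splitAt-length d P (<⇒≤ d<e)
... | L , S , refl , refl = (L , S , R) , ++-assoc L S R , refl , length-++ L

isNetOcc⇒netOccurrence : ∀ {T} L S R → T ≡ L ++ S ++ R → IsNetOcc T (suc (length L)) (length L + length S) →
                         NetOccurrence T (last L) S (head R)
isNetOcc⇒netOccurrence L S R refl (repeated , left , right) =
    subst (λ w → 2 ≤ occCount w (L ++ S ++ R)) (sub-++ L S R) repeated
  , left-unique (initLast L) left
  , right-unique R right
  where
  left-unique : ∀ {L} → InitLast L →
    (suc (length L) ≡ 1) ⊎ (occCount (sub (L ++ S ++ R) (length L) (length L + length S)) (L ++ S ++ R) ≡ 1) →
    All (λ x → occCount (x ∷ S) (L ++ S ++ R) ≡ 1) (last L)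
  left-unique []         _           = nothing
  left-unique (L₀ ∷ʳ′ x) (inj₁ e)    with () ← trans (sym (length-∷ʳ L₀ x)) (suc-injective e)
  left-unique (L₀ ∷ʳ′ x) (inj₂ once) =
    subst (All _) (sym (last-∷ʳ L₀ x))
          (just (subst (λ w → occCount w ((L₀ ∷ʳ x) ++ S ++ R) ≡ 1) extension≡ once))
    where
    extension≡ : sub ((L₀ ∷ʳ x) ++ S ++ R) (length (L₀ ∷ʳ x)) (length (L₀ ∷ʳ x) + length S) ≡ x ∷ S
    extension≡ = sub-factor L₀ (x ∷ S) R (++-assoc L₀ (x ∷ []) (S ++ R)) (length-∷ʳ L₀ x)
                            (trans (cong (_+ length S) (length-∷ʳ L₀ x)) (sym (+-suc (length L₀) (length S))))
  right-unique : ∀ R →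
    (length L + length S ≡ length (L ++ S ++ R)) ⊎
    (occCount (sub (L ++ S ++ R) (suc (length L)) (suc (length L + length S))) (L ++ S ++ R) ≡ 1) →
    All (λ y → occCount (S ∷ʳ y) (L ++ S ++ R) ≡ 1) (head R)
  right-unique []      _           = nothing
  right-unique (y ∷ R) (inj₁ e)    = ⊥-elim (m≢1+m+n (length S) (+-cancelˡ-≡ (length L) _ _
    (trans e (trans (length-factor L S (y ∷ R)) (cong (length L +_) (+-suc (length S) (length R)))))))
  right-unique (y ∷ R) (inj₂ once) = just (subst (λ w → occCount w (L ++ S ++ y ∷ R) ≡ 1) extension≡ once)
    where
    extension≡ : sub (L ++ S ++ y ∷ R) (suc (length L)) (suc (length L + length S)) ≡ S ∷ʳ y
    extension≡ = sub-factor L (S ∷ʳ y) R (cong (L ++_) (sym (++-assoc S (y ∷ []) R))) refl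
                            (trans (sym (+-suc (length L) (length S))) (cong (length L +_) (sym (length-∷ʳ S y))))

properSuperOcc⇒infix : ∀ {T w} L S R → T ≡ L ++ S ++ R →
                       ProperSuperOccOf T (suc (length L)) (length L + length S) w → Infix w S
properSuperOcc⇒infix L S R refl (s′ , e′ , s≤s′ , s′≤e′ , e′≤e , _ , sub≡w)
  with occurrence⇒factorization (L ++ S ++ R) (≤-trans (s≤s z≤n) s≤s′ , s′≤e′ , ≤-trans e′≤e within)
  where
  within : length L + length S ≤ length (L ++ S ++ R)
  within = ≤-trans (+-monoʳ-≤ (length L) (m≤m+n (length S) (length R))) (≤-reflexive (sym (length-factor L S R)))
... | (L′ , w′ , R′) , eq , refl , refl with trans (sym (sub-factor L′ w′ R′ eq refl refl)) sub≡w
... | refl with ++-split-≤ L L′ eq (≤-pred s≤s′)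
... | α , refl , SR≡ with ++-split-≤ (α ++ w′) S (trans (++-assoc α w′ R′) (sym SR≡)) α++w≤S
  where
  α++w≤S : length (α ++ w′) ≤ length S
  α++w≤S = +-cancelˡ-≤ (length L) _ _ (≤-trans (≤-reflexive (sym lengths)) e′≤e)
    where
    lengths : length (L ++ α) + length w′ ≡ length L + length (α ++ w′)
    lengths = trans (sym (length-++ (L ++ α))) (trans (cong length (++-assoc L α w′)) (length-++ L))
... | β , S≡ , _ = α , β , trans S≡ (++-assoc α w′ β)

lemma39 : (i : ℕ) → 5 ≤ i → (s e : ℕ) → IsOcc (TM i) s e
    → (ProperSuperOccOf (TM i) s e (TM (i ∸ 3)) ⊎ ProperSuperOccOf (TM i) s e (bar (TM (i ∸ 3))))
    → sub (TM i) s e ≢ TM (i ∸ 2)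
    → sub (TM i) s e ≢ bar (TM (i ∸ 2))
    → sub (TM i) s e ≢ TM (i ∸ 4) ++ bar (TM (i ∸ 3))
    → sub (TM i) s e ≢ bar (TM (i ∸ 4)) ++ TM (i ∸ 3)
    → ¬ IsNetOcc (TM i) s e
lemma39 i 5≤i s e occurrence super ≢T ≢T̄ ≢TT̄ ≢T̄T net
  with m≤n⇒∃[o]m+o≡n 5≤i | occurrence⇒factorization (TM i) occurrence
... | k , refl | (L , S , R) , T≡ , refl , refl =
  S∉𝒫 (net⇒∈𝒫 k L S R T≡ contains (isNetOcc⇒netOccurrence L S R T≡ net))
  where
  sub≡S : sub (TM (5 + k)) (suc (length L)) (length L + length S) ≡ S
  sub≡S = sub-factor L S R T≡ refl refl
  contains : ContainsTM (2 + k) S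
  contains = Sum.map (properSuperOcc⇒infix L S R T≡) (properSuperOcc⇒infix L S R T≡) super
  S∉𝒫 : S ∉ 𝒫 (5 + k)
  S∉𝒫 (here S≡)                         = ≢T (trans sub≡S S≡)
  S∉𝒫 (there (here S≡))                 = ≢T̄ (trans sub≡S S≡)
  S∉𝒫 (there (there (here S≡)))         = ≢TT̄ (trans sub≡S S≡)
  S∉𝒫 (there (there (there (here S≡)))) = ≢T̄T (trans sub≡S S≡)
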